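{- Let $\mathcal{H}$ be a connected $r$-uniform hypergraph with $n+1$ vertices, and let $B$ be its generalized incidence matrix. Then the rank of $B$ is $n$.
   Context: An $r$-uniform hypergraph is a pair $(V,E)$ with $V$ finite and each edge an $r$-element subset of $V$; it is connected if any two vertices are joined by an alternating vertex–edge walk with consecutive elements incident. An incidence is a pair $(u,e)$ with $e\in E$, $u\in e$. The generalized incidence matrix $B$ has rows indexed by vertices and columns indexed by incidences, with $B_{v,(u,e)}=r-1$ if $v=u\in e$, $B_{v,(u,e)}=-1$ if $v,u\in e$ and $v\ne u$, and $B_{v,(u,e)}=0$ otherwise. -}

module Defs where

open import Data.Nat using (ℕ; zero; suc)
open import Data.Fin using (Fin; zero; suc; _≟_)
open import Data.Fin.Subset using (Subset; _∈_; ∣_∣)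
open import Data.List using (List; length; lookup)
open import Data.List.Membership.Propositional renaming (_∈_ to _∈ₗ_)
open import Data.List.Relation.Unary.Unique.Propositional using (Unique)
open import Data.List.Relation.Unary.All using (All)
open import Data.Vec using () renaming (lookup to vlookup)
open import Data.Bool using (Bool; true; false; if_then_else_)
open import Data.Product using (Σ; Σ-syntax; ∃; _×_; _,_)
open import Data.Integer using (ℤ; +_) renaming (_-_ to _-ℤ_)
open import Data.Rational using (ℚ; 0ℚ; _+_; _*_; _/_; -_)
open import Relation.Nullary using (yes; no)
open import Relation.Binary.PropositionalEquality using (_≡_)
open import Relation.Binary.Construct.Closure.ReflexiveTransitive using (Star)

record Hypergraph (r m : ℕ) : Set where
  field
    edges   : List (Subset m)
    uniform : All (λ e → ∣ e ∣ ≡ r) edges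
    noDup   : Unique edges
open Hypergraph public

nE : ∀ {r m} → Hypergraph r m → ℕ
nE H = length (edges H)

edge : ∀ {r m} (H : Hypergraph r m) → Fin (nE H) → Subset m
edge H i = lookup (edges H) i

-- u and v lie in a common edge (one step e of an alternating vertex–edge walk u, e, v).
CoIncident : ∀ {r m} → Hypergraph r m → Fin m → Fin m → Set
CoIncident {m = m} H u v = Σ[ e ∈ Subset m ] (e ∈ₗ edges H × u ∈ e × v ∈ e)


Connected : ∀ {r m} → Hypergraph r m → Set
Connected {m = m} H = (u v : Fin m) → Star (CoIncident H) u v

Incidence : ∀ {r m} → Hypergraph r m → Set
Incidence {m = m} H = Σ[ i ∈ Fin (nE H) ] Σ[ u ∈ Fin m ] (u ∈ edge H i)

ℤ→ℚ : ℤ → ℚ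
ℤ→ℚ z = z / 1

genIncidence : ∀ {r m} (H : Hypergraph r m) → Fin m → Incidence H → ℚ
genIncidence {r} H v (i , u , _) with v ≟ u
... | yes _ = ℤ→ℚ ((+ r) -ℤ (+ 1))
... | no  _ = if vlookup (edge H i) v then ℤ→ℚ (Data.Integer.-[1+ 0 ]) else 0ℚ
  where import Data.Integer

∑ : ∀ k → (Fin k → ℚ) → ℚ
∑ zero    f = 0ℚ
∑ (suc k) f = f zero + ∑ k (λ j → f (suc j))

LinIndepCols : ∀ {m} {I : Set} → (Fin m → I → ℚ) → ∀ k → (Fin k → I) → Set
LinIndepCols {m} M k c =
  (a : Fin k → ℚ) → ((v : Fin m) → ∑ k (λ j → a j * M v (c j)) ≡ 0ℚ) → (j : Fin k) → a j ≡ 0ℚ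

HasRank : ∀ {m} {I : Set} → (Fin m → I → ℚ) → ℕ → Set
HasRank M k =
  Σ[ c ∈ (Fin k → _) ] LinIndepCols M k c
  × ((c : Fin (suc k) → _) → LinIndepCols M (suc k) c → Data.Empty.⊥)
  where import Data.Empty

-- The columns of B all sum to zero: the column of the incidence (u , e) is r·e_u − 1_e and
-- |e| = r.  Hence the columns lie in an n-dimensional hyperplane and rank B ≤ n.
-- Conversely, if u and w lie in a common edge e then e_w − e_u = (B(w,e) − B(u,e)) / r, so along
-- the walks given by connectivity every e_v − e_0 lies in the column space.  These n vectors are
-- independent, and an exchange argument turns them into n independent columns.
-- The linear algebra needed (more than m vectors in ℚ^m are dependent, with independence decidable)
-- is obtained by Gaussian elimination on the first coordinate.
module Submission where

open import Defs
open import Data.Nat as ℕ using (ℕ; zero; suc; _≤_; _<_; z≤n; s≤s)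
import Data.Nat.Properties as ℕ
import Data.Nat.Coprimality as Coprime
import Data.Integer as ℤ
import Data.Integer.Properties as ℤ
open import Data.Rational using (ℚ; mkℚ; 0ℚ; 1ℚ; _+_; _*_; -_; _-_; 1/_; ↥_; NonZero; ≢-nonZero)
open import Data.Rational.Properties renaming (_≟_ to _≟ℚ_)
  using ( fromℚᵘ-toℚᵘ; 1≢0; +-identityʳ; +-identityˡ; +-inverseʳ; *-identityʳ; *-identityˡ
        ; *-zeroˡ; *-zeroʳ; *-assoc; *-comm; *-distribʳ-+; *-inverseˡ; +-0-group; +-*-commutativeRing)
open import Data.Rational.Solver using (module +-*-Solver)
open import Algebra.Bundles using (CommutativeRing)
open import Algebra.Properties.Group +-0-group using (inverseʳ-unique)
open import Algebra.Properties.Semiring.Sum (CommutativeRing.semiring +-*-commutativeRing)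
  using (sum; sum-cong-≗; sum-replicate-zero; sum-remove; ∑-distrib-+; ∑-comm; *-distribˡ-sum; *-distribʳ-sum)
open import Data.Fin using (Fin; zero; suc; _≟_; punchIn; punchOut)
open import Data.Fin.Properties using (suc-injective; all?; ¬∀⟶∃¬; ∀-cons; sequence; punchInᵢ≢i; punchIn-punchOut)
open import Data.Fin.Subset using (Subset) renaming (_∈_ to _∈ₛ_; ∣_∣ to ∣_∣ₛ)
open import Data.Fin.Subset.Properties using (x∈p⇒∣p-x∣<∣p∣)
open import Data.Vec using ([]; _∷_) renaming (lookup to vlookup)
open import Data.Vec.Properties using ([]=⇒lookup)
open import Data.Vec.Functional using (removeAt; insertAt; tail) renaming (_∷_ to _◂_)
open import Data.Vec.Functional.Properties using (insertAt-lookup; insertAt-punchIn)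
import Data.List.Relation.Unary.All as All
import Data.List.Relation.Unary.Any as Any
open import Data.List.Relation.Unary.Any.Properties using (lookup-index)
open import Data.List.Membership.Propositional.Properties using (∈-lookup)
open import Data.Bool using (true; false; if_then_else_)
open import Data.Product using (Σ-syntax; ∃; _×_; _,_; proj₁; proj₂)
open import Data.Sum as Sum using (_⊎_; inj₁; inj₂)
import Data.Sum.Effectful.Left as SumLeft
open import Level using (0ℓ)
open import Data.Empty using (⊥)
open import Function using (_∘_)
open import Relation.Nullary using (¬_; yes; no; does; contradiction)
open import Relation.Nullary.Decidable using (dec-true; dec-false)
open import Relation.Binary.PropositionalEquality
open import Relation.Binary.Construct.Closure.ReflexiveTransitive using (Star; ε; _◅_)

open +-*-Solver

ℤ→ℚ≡mkℚ : ∀ i → ℤ→ℚ i ≡ mkℚ i 0 (Coprime.sym (Coprime.1-coprimeTo ℤ.∣ i ∣))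
ℤ→ℚ≡mkℚ i = fromℚᵘ-toℚᵘ (mkℚ i 0 _)

-- On denominators 1, addition of rationals computes to (i * 1 + j * 1) / 1.
ℤ→ℚ-+ : ∀ i j → ℤ→ℚ (i ℤ.+ j) ≡ ℤ→ℚ i + ℤ→ℚ j
ℤ→ℚ-+ i j = sym (begin
  ℤ→ℚ i + ℤ→ℚ j                      ≡⟨ cong₂ _+_ (ℤ→ℚ≡mkℚ i) (ℤ→ℚ≡mkℚ j) ⟩
  ℤ→ℚ (i ℤ.* ℤ.+ 1 ℤ.+ j ℤ.* ℤ.+ 1)  ≡⟨ cong ℤ→ℚ (cong₂ ℤ._+_ (ℤ.*-identityʳ i) (ℤ.*-identityʳ j)) ⟩
  ℤ→ℚ (i ℤ.+ j)                      ∎)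
  where open ≡-Reasoning

ℤ→ℚ-pos≢0 : ∀ {k} → 0 < k → ℤ→ℚ (ℤ.+ k) ≢ 0ℚ
ℤ→ℚ-pos≢0 {suc k} _ eq with cong ↥_ (trans (sym (ℤ→ℚ≡mkℚ (ℤ.+ suc k))) eq)
... | ()

*-+-≡0⇒≡ : ∀ p .{{_ : NonZero p}} {q s} → p * q + s ≡ 0ℚ → q ≡ - (1/ p) * s
*-+-≡0⇒≡ p {q} {s} eq = begin
  q                              ≡⟨ solve 1 (λ q → q := con 1ℚ :* q) refl q ⟩
  1ℚ * q                         ≡⟨ cong (_* q) (sym (*-inverseˡ p)) ⟩
  1/ p * p * q                   ≡⟨ solve 4 (λ i p q s → i :* p :* q := i :* (p :* q :+ s) :- i :* s) refl (1/ p) p q s ⟩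
  1/ p * (p * q + s) - 1/ p * s  ≡⟨ cong (λ t → 1/ p * t - 1/ p * s) eq ⟩
  1/ p * 0ℚ - 1/ p * s           ≡⟨ solve 2 (λ i s → i :* con 0ℚ :- i :* s := :- i :* s) refl (1/ p) s ⟩
  - (1/ p) * s                   ∎
  where open ≡-Reasoning

*-cancelˡ-≡0 : ∀ {p q} → p ≢ 0ℚ → p * q ≡ 0ℚ → q ≡ 0ℚ
*-cancelˡ-≡0 {p} {q} p≢0 pq≡0 = begin
  q                ≡⟨ *-+-≡0⇒≡ p (trans (+-identityʳ (p * q)) pq≡0) ⟩
  - (1/ p) * 0ℚ    ≡⟨ *-zeroʳ (- (1/ p)) ⟩
  0ℚ               ∎
  where
  open ≡-Reasoning
  instance
    p-nonZero : NonZero p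
    p-nonZero = ≢-nonZero p≢0

∑≡sum : ∀ k f → ∑ k f ≡ sum f
∑≡sum zero    f = refl
∑≡sum (suc k) f = cong (f zero +_) (∑≡sum k (tail f))

sum-zero : ∀ {k} {f : Fin k → ℚ} → (∀ i → f i ≡ 0ℚ) → sum f ≡ 0ℚ
sum-zero {k} f≗0 = trans (sum-cong-≗ f≗0) (sum-replicate-zero k)

sum-neg : ∀ {k} (f : Fin k → ℚ) → sum {k} (λ i → - f i) ≡ - sum f
sum-neg {k} f = begin
  sum {k} (λ i → - f i)       ≡⟨ sum-cong-≗ {k} (λ i → solve 1 (λ a → :- a := con (- 1ℚ) :* a) refl (f i)) ⟩
  sum {k} (λ i → - 1ℚ * f i)  ≡⟨ sym (*-distribˡ-sum (- 1ℚ) f) ⟩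
  - 1ℚ * sum f                ≡⟨ solve 1 (λ a → con (- 1ℚ) :* a := :- a) refl (sum f) ⟩
  - sum f                     ∎
  where open ≡-Reasoning

sum-single : ∀ {k} {f : Fin (suc k) → ℚ} j → (∀ i → i ≢ j → f i ≡ 0ℚ) → sum f ≡ f j
sum-single {f = f} j off = begin
  sum f                     ≡⟨ sum-remove f ⟩
  f j + sum (removeAt f j)  ≡⟨ cong (f j +_) (sum-zero (λ i → off (punchIn j i) (punchInᵢ≢i j i))) ⟩
  f j + 0ℚ                  ≡⟨ +-identityʳ (f j) ⟩
  f j                       ∎
  where open ≡-Reasoning

lin : ∀ {k m} → (Fin k → ℚ) → (Fin k → Fin m → ℚ) → Fin m → ℚ
lin {k} a V x = sum {k} (λ j → a j * V j x)

Independent : ∀ {k m} → (Fin k → Fin m → ℚ) → Set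
Independent V = ∀ a → (∀ x → lin a V x ≡ 0ℚ) → ∀ j → a j ≡ 0ℚ

Dependent : ∀ {k m} → (Fin k → Fin m → ℚ) → Set
Dependent {k} V = Σ[ a ∈ (Fin k → ℚ) ] (∀ x → lin a V x ≡ 0ℚ) × ∃ λ j → a j ≢ 0ℚ

dependent⇒¬independent : ∀ {k m} {V : Fin k → Fin m → ℚ} → Dependent V → ¬ Independent V
dependent⇒¬independent (a , a·V≡0 , j , aj≢0) indep = aj≢0 (indep a a·V≡0 j)

lin-zero : ∀ {k m} {a : Fin k → ℚ} (V : Fin k → Fin m → ℚ) x → (∀ j → a j ≡ 0ℚ) → lin a V x ≡ 0ℚ
lin-zero V x a≡0 = sum-zero (λ j → trans (cong (_* V j x) (a≡0 j)) (*-zeroˡ (V j x)))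

lin-*ˡ : ∀ {k m} c (a : Fin k → ℚ) (V : Fin k → Fin m → ℚ) x → lin (λ j → c * a j) V x ≡ c * lin a V x
lin-*ˡ {k} c a V x =
  trans (sum-cong-≗ {k} (λ j → *-assoc c (a j) (V j x))) (sym (*-distribˡ-sum c (λ j → a j * V j x)))

lin-+ : ∀ {k m} (a b : Fin k → ℚ) (V : Fin k → Fin m → ℚ) x → lin (λ j → a j + b j) V x ≡ lin a V x + lin b V x
lin-+ {k} a b V x =
  trans (sum-cong-≗ {k} (λ j → *-distribʳ-+ (V j x) (a j) (b j))) (∑-distrib-+ (λ j → a j * V j x) (λ j → b j * V j x))

lin-removeAt : ∀ {k m} a (V : Fin (suc k) → Fin m → ℚ) x p →
               lin a V x ≡ a p * V p x + lin (removeAt a p) (removeAt V p) x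
lin-removeAt a V x p = sum-remove (λ j → a j * V j x)

lin-assoc : ∀ {k s m} (a : Fin k → ℚ) (B : Fin k → Fin s → ℚ) (U : Fin s → Fin m → ℚ) x →
            lin a (λ i → lin (B i) U) x ≡ lin (lin a B) U x
lin-assoc {k} {s} a B U x = begin
  sum {k} (λ i → a i * sum {s} (λ t → B i t * U t x))
    ≡⟨ sum-cong-≗ {k} (λ i → *-distribˡ-sum (a i) (λ t → B i t * U t x)) ⟩
  sum {k} (λ i → sum {s} (λ t → a i * (B i t * U t x)))
    ≡⟨ ∑-comm (λ i t → a i * (B i t * U t x)) ⟩
  sum {s} (λ t → sum {k} (λ i → a i * (B i t * U t x)))
    ≡⟨ sum-cong-≗ (λ t → sum-cong-≗ (λ i → sym (*-assoc (a i) (B i t) (U t x)))) ⟩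
  sum {s} (λ t → sum {k} (λ i → a i * B i t * U t x))
    ≡⟨ sum-cong-≗ {s} (λ t → sym (*-distribʳ-sum (U t x) (λ i → a i * B i t))) ⟩
  sum {s} (λ t → lin a B t * U t x)
    ∎
  where open ≡-Reasoning

sum-lin : ∀ {k m} (a : Fin k → ℚ) (V : Fin k → Fin m → ℚ) → sum (lin a V) ≡ sum {k} (λ j → a j * sum (V j))
sum-lin {k} a V = trans (∑-comm (λ x j → a j * V j x)) (sum-cong-≗ {k} (λ j → sym (*-distribˡ-sum (a j) (V j))))

module Pivot {k m} (V : Fin (suc k) → Fin (suc m) → ℚ) (p : Fin (suc k)) where

  π : ℚ
  π = V p zero

  V̂ : Fin k → Fin (suc m) → ℚ
  V̂ = removeAt V p

  eliminated : Fin k → Fin m → ℚ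
  eliminated i y = π * V̂ i (suc y) - V̂ i zero * V p (suc y)

  lin-eliminated : ∀ b y → lin b eliminated y ≡ π * lin b V̂ (suc y) - lin b V̂ zero * V p (suc y)
  lin-eliminated b y = begin
    lin b eliminated y
      ≡⟨ sum-cong-≗ {k} (λ i → solve 5 (λ b π w μ v → b :* (π :* w :- μ :* v) := π :* (b :* w) :+ (b :* μ) :* (:- v))
                                        refl (b i) π (V̂ i (suc y)) (V̂ i zero) v) ⟩
    sum {k} (λ i → π * (b i * V̂ i (suc y)) + b i * V̂ i zero * - v)
      ≡⟨ ∑-distrib-+ (λ i → π * (b i * V̂ i (suc y))) (λ i → b i * V̂ i zero * - v) ⟩
    sum {k} (λ i → π * (b i * V̂ i (suc y))) + sum {k} (λ i → b i * V̂ i zero * - v)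
      ≡⟨ cong₂ _+_ (sym (*-distribˡ-sum π (λ i → b i * V̂ i (suc y))))
                   (sym (*-distribʳ-sum (- v) (λ i → b i * V̂ i zero))) ⟩
    π * lin b V̂ (suc y) + lin b V̂ zero * - v
      ≡⟨ solve 3 (λ s t v → s :+ t :* (:- v) := s :- t :* v) refl (π * lin b V̂ (suc y)) (lin b V̂ zero) v ⟩
    π * lin b V̂ (suc y) - lin b V̂ zero * v
      ∎
    where open ≡-Reasoning
          v : ℚ
          v = V p (suc y)

  module _ (π≢0 : π ≢ 0ℚ) where

    eliminated-dependent : Dependent eliminated → Dependent V
    eliminated-dependent (b , b·E≡0 , t , bt≢0) = a , a·V≡0 , punchIn p t , at≢0
      where
      open ≡-Reasoning
      S : ℚ
      S = lin b V̂ zero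
      a : Fin (suc k) → ℚ
      a = insertAt (λ i → π * b i) p (- S)
      lin-a : ∀ x → lin a V x ≡ - S * V p x + π * lin b V̂ x
      lin-a x = begin
        lin a V x                               ≡⟨ lin-removeAt a V x p ⟩
        a p * V p x + lin (removeAt a p) V̂ x   ≡⟨ cong₂ (λ c d → c * V p x + d) (insertAt-lookup _ p (- S))
                                                     (sum-cong-≗ {k} (λ i → cong (_* V̂ i x) (insertAt-punchIn _ p (- S) i))) ⟩
        - S * V p x + lin (λ i → π * b i) V̂ x  ≡⟨ cong (- S * V p x +_) (lin-*ˡ π b V̂ x) ⟩
        - S * V p x + π * lin b V̂ x            ∎
      a·V≡0 : ∀ x → lin a V x ≡ 0ℚ
      a·V≡0 zero    = trans (lin-a zero) (solve 2 (λ s π → :- s :* π :+ π :* s := con 0ℚ) refl S π)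
      a·V≡0 (suc y) = begin
        lin a V (suc y)                          ≡⟨ lin-a (suc y) ⟩
        - S * V p (suc y) + π * lin b V̂ (suc y)  ≡⟨ solve 3 (λ s v t → :- s :* v :+ t := t :- s :* v) refl S (V p (suc y)) _ ⟩
        π * lin b V̂ (suc y) - S * V p (suc y)    ≡⟨ sym (lin-eliminated b y) ⟩
        lin b eliminated y                       ≡⟨ b·E≡0 y ⟩
        0ℚ                                       ∎
      at≢0 : a (punchIn p t) ≢ 0ℚ
      at≢0 at≡0 = bt≢0 (*-cancelˡ-≡0 π≢0 (trans (sym (insertAt-punchIn _ p (- S) t)) at≡0))

    eliminated-independent : Independent eliminated → Independent V
    eliminated-independent indep a a·V≡0 = a≡0
      where
      open ≡-Reasoning
      â : Fin k → ℚ
      â = removeAt a p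
      lin-â : ∀ x → lin â V̂ x ≡ - (a p * V p x)
      lin-â x = inverseʳ-unique (a p * V p x) (lin â V̂ x) (trans (sym (lin-removeAt a V x p)) (a·V≡0 x))
      â≡0 : ∀ i → â i ≡ 0ℚ
      â≡0 = indep â λ y → begin
        lin â eliminated y
          ≡⟨ lin-eliminated â y ⟩
        π * lin â V̂ (suc y) - lin â V̂ zero * V p (suc y)
          ≡⟨ cong₂ (λ c d → π * c - d * V p (suc y)) (lin-â (suc y)) (lin-â zero) ⟩
        π * - (a p * V p (suc y)) - - (a p * π) * V p (suc y)
          ≡⟨ solve 3 (λ π a v → π :* (:- (a :* v)) :- (:- (a :* π)) :* v := con 0ℚ) refl π (a p) (V p (suc y)) ⟩
        0ℚ
          ∎
      ap≡0 : a p ≡ 0ℚ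
      ap≡0 = *-cancelˡ-≡0 π≢0 (begin
        π * a p                 ≡⟨ *-comm π (a p) ⟩
        a p * π                 ≡⟨ sym (+-identityʳ _) ⟩
        a p * π + 0ℚ            ≡⟨ cong (a p * π +_) (sym (lin-zero V̂ zero â≡0)) ⟩
        a p * π + lin â V̂ zero  ≡⟨ sym (lin-removeAt a V zero p) ⟩
        lin a V zero            ≡⟨ a·V≡0 zero ⟩
        0ℚ                      ∎)
      a≡0 : ∀ j → a j ≡ 0ℚ
      a≡0 j with p ≟ j
      ... | yes refl = ap≡0
      ... | no p≢j   = subst (λ i → a i ≡ 0ℚ) (punchIn-punchOut p≢j) (â≡0 (punchOut p≢j))

dependent⊎independent≤ : ∀ {k m} (V : Fin k → Fin m → ℚ) → Dependent V ⊎ (Independent V × k ≤ m)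
dependent⊎independent≤ {zero}          V = inj₂ ((λ _ _ ()) , z≤n)
dependent⊎independent≤ {suc k} {zero}  V = inj₁ ((λ _ → 1ℚ) , (λ ()) , zero , 1≢0)
dependent⊎independent≤ {suc k} {suc m} V with all? (λ j → V j zero ≟ℚ 0ℚ)
... | yes firstRow≡0 with dependent⊎independent≤ (λ j y → V j (suc y))
...   | inj₁ (a , a·V′≡0 , a≢0) = inj₁ (a , a·V≡0 , a≢0)
  where
  a·V≡0 : ∀ x → lin a V x ≡ 0ℚ
  a·V≡0 zero    = sum-zero (λ j → trans (cong (a j *_) (firstRow≡0 j)) (*-zeroʳ (a j)))
  a·V≡0 (suc y) = a·V′≡0 y
...   | inj₂ (indep , k≤m) = inj₂ ((λ a a·V≡0 → indep a (λ y → a·V≡0 (suc y))) , ℕ.m≤n⇒m≤1+n k≤m)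
dependent⊎independent≤ {suc k} {suc m} V | no ¬firstRow≡0
  with (p , π≢0) ← ¬∀⟶∃¬ _ _ (λ j → V j zero ≟ℚ 0ℚ) ¬firstRow≡0
  with dependent⊎independent≤ (Pivot.eliminated V p)
... | inj₁ dep           = inj₁ (Pivot.eliminated-dependent V p π≢0 dep)
... | inj₂ (indep , k≤m) = inj₂ (Pivot.eliminated-independent V p π≢0 indep , s≤s k≤m)

independent? : ∀ {k m} (V : Fin k → Fin m → ℚ) → Dependent V ⊎ Independent V
independent? V = Sum.map₂ proj₁ (dependent⊎independent≤ V)

independent⇒≤ : ∀ {k m} {V : Fin k → Fin m → ℚ} → Independent V → k ≤ m
independent⇒≤ {V = V} indep with dependent⊎independent≤ V
... | inj₁ dep       = contradiction indep (dependent⇒¬independent dep)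
... | inj₂ (_ , k≤m) = k≤m

-- The first coordinate of a combination of such vectors is minus the sum of the others.
sumZero-independent⇒≤ : ∀ {k d} {V : Fin k → Fin (suc d) → ℚ} → (∀ j → sum (V j) ≡ 0ℚ) → Independent V → k ≤ d
sumZero-independent⇒≤ {k} {V = V} ΣV≡0 indep = independent⇒≤ tail-independent
  where
  tail-independent : Independent (λ j y → V j (suc y))
  tail-independent a a·V′≡0 = indep a a·V≡0
    where
    a·V≡0 : ∀ x → lin a V x ≡ 0ℚ
    a·V≡0 (suc y) = a·V′≡0 y
    a·V≡0 zero    = begin
      lin a V zero                       ≡⟨ sym (+-identityʳ _) ⟩
      lin a V zero + 0ℚ                  ≡⟨ cong (lin a V zero +_) (sym (sum-zero a·V′≡0)) ⟩
      sum (lin a V)                      ≡⟨ sum-lin a V ⟩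
      sum {k} (λ j → a j * sum (V j))    ≡⟨ sum-zero (λ j → trans (cong (a j *_) (ΣV≡0 j)) (*-zeroʳ (a j))) ⟩
      0ℚ                                 ∎
      where open ≡-Reasoning

InSpan : ∀ {s d} → (Fin s → Fin d → ℚ) → (Fin d → ℚ) → Set
InSpan {s} U w = Σ[ β ∈ (Fin s → ℚ) ] ∀ x → w x ≡ lin β U x

inSpan-0 : ∀ {s d} (U : Fin s → Fin d → ℚ) → InSpan U (λ _ → 0ℚ)
inSpan-0 U = (λ _ → 0ℚ) , λ x → sym (lin-zero U x (λ _ → refl))

inSpan-+ : ∀ {s d} {U : Fin s → Fin d → ℚ} {v w} → InSpan U v → InSpan U w → InSpan U (λ x → v x + w x)
inSpan-+ {U = U} (β , v≡) (γ , w≡) = (λ t → β t + γ t) , λ x → trans (cong₂ _+_ (v≡ x) (w≡ x)) (sym (lin-+ β γ U x))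

inSpan-* : ∀ {s d} {U : Fin s → Fin d → ℚ} {w} c → InSpan U w → InSpan U (λ x → c * w x)
inSpan-* {U = U} c (β , w≡) = (λ t → c * β t) , λ x → trans (cong (c *_) (w≡ x)) (sym (lin-*ˡ c β U x))

inSpan-≗ : ∀ {s d} {U : Fin s → Fin d → ℚ} {v w} → (∀ x → v x ≡ w x) → InSpan U v → InSpan U w
inSpan-≗ v≗w (β , v≡) = β , λ x → trans (sym (v≗w x)) (v≡ x)

independent-inSpan⇒≤ : ∀ {m s d} {W : Fin m → Fin d → ℚ} {U : Fin s → Fin d → ℚ} →
                       Independent W → (∀ i → InSpan U (W i)) → m ≤ s
independent-inSpan⇒≤ {m} {s} {W = W} {U} indep W⊆U = independent⇒≤ coordinates-independent
  where
  B : Fin m → Fin s → ℚ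
  B i = proj₁ (W⊆U i)
  coordinates-independent : Independent B
  coordinates-independent a a·B≡0 = indep a λ x → begin
    lin a W x                    ≡⟨ sum-cong-≗ {m} (λ i → cong (a i *_) (proj₂ (W⊆U i) x)) ⟩
    lin a (λ i → lin (B i) U) x  ≡⟨ lin-assoc a B U x ⟩
    lin (lin a B) U x            ≡⟨ lin-zero U x a·B≡0 ⟩
    0ℚ                           ∎
    where open ≡-Reasoning

module Columns {d} {I : Set} (M : Fin d → I → ℚ) where

  columns : ∀ {s} → (Fin s → I) → Fin s → Fin d → ℚ
  columns c j x = M x (c j)

  data Span : (Fin d → ℚ) → Set where
    span-column : ∀ i → Span (λ x → M x i)
    span-0      : Span (λ _ → 0ℚ)
    span-+      : ∀ {v w} → Span v → Span w → Span (λ x → v x + w x)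
    span-*      : ∀ {w} c → Span w → Span (λ x → c * w x)
    span-≗      : ∀ {v w} → (∀ x → v x ≡ w x) → Span v → Span w

  Extends : ∀ {s} → (Fin s → I) → Set
  Extends c = ∃ λ i → Independent (columns (i ◂ c))

  -- A dependency among column i and the independent columns c must involve column i.
  column-extends⊎inSpan : ∀ {s} {c : Fin s → I} → Independent (columns c) → ∀ i →
                          Extends c ⊎ InSpan (columns c) (λ x → M x i)
  column-extends⊎inSpan {c = c} indep i with independent? (columns (i ◂ c))
  ... | inj₂ indep′ = inj₁ (i , indep′)
  ... | inj₁ (a , a·C≡0 , j , aj≢0) with a zero ≟ℚ 0ℚ
  ...   | yes a₀≡0 = contradiction (∀-cons {P = λ j → a j ≡ 0ℚ} a₀≡0 (indep (tail a) tail·c≡0) j) aj≢0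
    where
    tail·c≡0 : ∀ x → lin (tail a) (columns c) x ≡ 0ℚ
    tail·c≡0 x = trans (solve 2 (λ u t → t := con 0ℚ :* u :+ t) refl (M x i) _)
                       (trans (cong (λ a₀ → a₀ * M x i + lin (tail a) (columns c) x) (sym a₀≡0)) (a·C≡0 x))
  ...   | no a₀≢0 = inj₂ ((λ t → - (1/ a zero) * a (suc t)) , λ x →
                      trans (*-+-≡0⇒≡ (a zero) (a·C≡0 x)) (sym (lin-*ˡ (- (1/ a zero)) (tail a) (columns c) x)))
    where
    instance
      a₀-nonZero : NonZero (a zero)
      a₀-nonZero = ≢-nonZero a₀≢0

  extends⊎inSpan : ∀ {s} {c : Fin s → I} → Independent (columns c) → ∀ {w} → Span w →
                   Extends c ⊎ InSpan (columns c) w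
  extends⊎inSpan indep (span-column i) = column-extends⊎inSpan indep i
  extends⊎inSpan indep span-0          = inj₂ (inSpan-0 _)
  extends⊎inSpan indep (span-+ v w) with extends⊎inSpan indep v | extends⊎inSpan indep w
  ... | inj₁ ext | _        = inj₁ ext
  ... | inj₂ _   | inj₁ ext = inj₁ ext
  ... | inj₂ v∈  | inj₂ w∈  = inj₂ (inSpan-+ v∈ w∈)
  extends⊎inSpan indep (span-* c w)   = Sum.map₂ (inSpan-* c) (extends⊎inSpan indep w)
  extends⊎inSpan indep (span-≗ v≗w v) = Sum.map₂ (inSpan-≗ v≗w) (extends⊎inSpan indep v)

  independent-columns : ∀ {m} {W : Fin m → Fin d → ℚ} → Independent W → (∀ i → Span (W i)) →
                        Σ[ c ∈ (Fin m → I) ] Independent (columns c)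
  independent-columns {m} indep spanned = grow m ℕ.≤-refl
    where
    grow : ∀ s → s ≤ m → Σ[ c ∈ (Fin s → I) ] Independent (columns c)
    grow zero    _   = (λ ()) , λ _ _ ()
    grow (suc s) s<m with grow s (ℕ.<⇒≤ s<m)
    ... | c , indep-c with sequence (SumLeft.applicative (Extends c) 0ℓ) (λ i → extends⊎inSpan indep-c (spanned i))
    ...   | inj₁ (i , indep′) = (i ◂ c) , indep′
    ...   | inj₂ W⊆C         = contradiction (independent-inSpan⇒≤ indep W⊆C) (ℕ.<⇒≱ s<m)

  independent⇒linIndepCols : ∀ {k} {c : Fin k → I} → Independent (columns c) → LinIndepCols M k c
  independent⇒linIndepCols {k} indep a a·C≡0 = indep a (λ x → trans (sym (∑≡sum k _)) (a·C≡0 x))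

  linIndepCols⇒independent : ∀ {k} {c : Fin k → I} → LinIndepCols M k c → Independent (columns c)
  linIndepCols⇒independent {k} indep a a·C≡0 = indep a (λ x → trans (∑≡sum k _) (a·C≡0 x))

δ : ∀ {m} → Fin m → Fin m → ℚ
δ u x = if does (u ≟ x) then 1ℚ else 0ℚ

δ-refl : ∀ {m} (u : Fin m) → δ u u ≡ 1ℚ
δ-refl u = cong (if_then 1ℚ else 0ℚ) (dec-true (u ≟ u) refl)

δ-≢ : ∀ {m} {u x : Fin m} → u ≢ x → δ u x ≡ 0ℚ
δ-≢ {u = u} {x} u≢x = cong (if_then 1ℚ else 0ℚ) (dec-false (u ≟ x) u≢x)

sum-δ : ∀ {m} (u : Fin m) → sum (δ u) ≡ 1ℚ
sum-δ {suc m} u = trans (sum-single u (λ x x≢u → δ-≢ (x≢u ∘ sym))) (δ-refl u)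

δ-differences-independent : ∀ {n} → Independent (λ (i : Fin n) x → δ (suc i) x - δ zero x)
δ-differences-independent {suc n} a a·D≡0 j = begin
  a j                                             ≡⟨ solve 1 (λ a → a := a :* (con 1ℚ :- con 0ℚ)) refl (a j) ⟩
  a j * (1ℚ - 0ℚ)                                 ≡⟨ cong (λ d → a j * (d - 0ℚ)) (sym (δ-refl (suc j))) ⟩
  a j * (δ (suc j) (suc j) - 0ℚ)                  ≡⟨ sym (sum-single j off-diagonal) ⟩
  lin a (λ i x → δ (suc i) x - δ zero x) (suc j)  ≡⟨ a·D≡0 (suc j) ⟩
  0ℚ                                              ∎
  where
  open ≡-Reasoning
  off-diagonal : ∀ i → i ≢ j → a i * (δ (suc i) (suc j) - 0ℚ) ≡ 0ℚ
  off-diagonal i i≢j = trans (cong (λ d → a i * (d - 0ℚ)) (δ-≢ (i≢j ∘ suc-injective)))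
                             (solve 1 (λ a → a :* (con 0ℚ :- con 0ℚ) := con 0ℚ) refl (a i))

indicator : ∀ {m} → Subset m → Fin m → ℚ
indicator e x = if vlookup e x then 1ℚ else 0ℚ

sum-indicator : ∀ {m} (e : Subset m) → sum (indicator e) ≡ ℤ→ℚ (ℤ.+ ∣ e ∣ₛ)
sum-indicator []          = refl
sum-indicator (true ∷ e)  = trans (cong (1ℚ +_) (sum-indicator e)) (sym (ℤ→ℚ-+ (ℤ.+ 1) (ℤ.+ ∣ e ∣ₛ)))
sum-indicator (false ∷ e) = trans (cong (0ℚ +_) (sum-indicator e)) (+-identityˡ _)

∈⇒∣∣>0 : ∀ {m} {u : Fin m} {e : Subset m} → u ∈ₛ e → 0 < ∣ e ∣ₛ
∈⇒∣∣>0 u∈e = ℕ.≤-<-trans z≤n (x∈p⇒∣p-x∣<∣p∣ u∈e)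

module _ {r m} (H : Hypergraph r m) where

  R : ℚ
  R = ℤ→ℚ (ℤ.+ r)

  ∣edge∣≡r : ∀ i → ∣ edge H i ∣ₛ ≡ r
  ∣edge∣≡r i = All.lookup (uniform H) (∈-lookup i)

  genIncidence-column : ∀ (ι : Incidence H) x →
                        genIncidence H x ι ≡ R * δ (proj₁ (proj₂ ι)) x - indicator (edge H (proj₁ ι)) x
  genIncidence-column (i , u , u∈e) x with x ≟ u
  ... | yes refl = begin
    ℤ→ℚ (ℤ.+ r ℤ.- ℤ.+ 1)              ≡⟨ ℤ→ℚ-+ (ℤ.+ r) (ℤ.- ℤ.+ 1) ⟩
    R - 1ℚ                             ≡⟨ cong (_- 1ℚ) (sym (*-identityʳ R)) ⟩
    R * 1ℚ - 1ℚ                        ≡⟨ cong₂ (λ d b → R * d - b) (sym (δ-refl x))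
                                                (cong (if_then 1ℚ else 0ℚ) (sym ([]=⇒lookup u∈e))) ⟩
    R * δ x x - indicator (edge H i) x ∎
    where open ≡-Reasoning
  ... | no x≢u rewrite δ-≢ (x≢u ∘ sym) with vlookup (edge H i) x
  ...   | true  = solve 1 (λ R → con (- 1ℚ) := R :* con 0ℚ :- con 1ℚ) refl R
  ...   | false = solve 1 (λ R → con 0ℚ := R :* con 0ℚ :- con 0ℚ) refl R

  genIncidence-column-sum : ∀ ι → sum (λ x → genIncidence H x ι) ≡ 0ℚ
  genIncidence-column-sum ι@(i , u , _) = begin
    sum (λ x → genIncidence H x ι)                      ≡⟨ sum-cong-≗ {m} (genIncidence-column ι) ⟩
    sum {m} (λ x → R * δ u x - χ x)                     ≡⟨ ∑-distrib-+ (λ x → R * δ u x) (λ x → - χ x) ⟩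
    sum {m} (λ x → R * δ u x) + sum {m} (λ x → - χ x)  ≡⟨ cong₂ _+_ (sym (*-distribˡ-sum R (δ u))) (sum-neg χ) ⟩
    R * sum (δ u) - sum χ                               ≡⟨ cong₂ (λ s t → R * s - t) (sum-δ u) (sum-indicator (edge H i)) ⟩
    R * 1ℚ - ℤ→ℚ (ℤ.+ ∣ edge H i ∣ₛ)                    ≡⟨ cong (λ k → R * 1ℚ - ℤ→ℚ (ℤ.+ k)) (∣edge∣≡r i) ⟩
    R * 1ℚ - R                                          ≡⟨ solve 1 (λ R → R :* con 1ℚ :- R := con 0ℚ) refl R ⟩
    0ℚ                                                  ∎
    where open ≡-Reasoning
          χ : Fin m → ℚ
          χ = indicator (edge H i)

  open Columns (genIncidence H)

  edge-span : ∀ i {u w} → u ∈ₛ edge H i → w ∈ₛ edge H i → Span (λ x → δ w x - δ u x)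
  edge-span i {u} {w} u∈e w∈e =
    span-≗ rescale (span-* (1/ R) (span-+ (span-column (i , w , w∈e)) (span-* (- 1ℚ) (span-column (i , u , u∈e)))))
    where
    instance
      R-nonZero : NonZero R
      R-nonZero = ≢-nonZero (ℤ→ℚ-pos≢0 (subst (0 <_) (∣edge∣≡r i) (∈⇒∣∣>0 u∈e)))
    χ : Fin m → ℚ
    χ = indicator (edge H i)
    rescale : ∀ x → 1/ R * (genIncidence H x (i , w , w∈e) + - 1ℚ * genIncidence H x (i , u , u∈e)) ≡ δ w x - δ u x
    rescale x = begin
      1/ R * (genIncidence H x (i , w , w∈e) + - 1ℚ * genIncidence H x (i , u , u∈e))
        ≡⟨ cong₂ (λ p q → 1/ R * (p + - 1ℚ * q))
                 (genIncidence-column (i , w , w∈e) x) (genIncidence-column (i , u , u∈e) x) ⟩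
      1/ R * ((R * δ w x - χ x) + - 1ℚ * (R * δ u x - χ x))
        ≡⟨ solve 5 (λ r R a b c → r :* ((R :* a :- c) :+ con (- 1ℚ) :* (R :* b :- c)) := r :* R :* (a :- b))
                   refl (1/ R) R (δ w x) (δ u x) (χ x) ⟩
      1/ R * R * (δ w x - δ u x)
        ≡⟨ cong (_* (δ w x - δ u x)) (*-inverseˡ R) ⟩
      1ℚ * (δ w x - δ u x)
        ≡⟨ *-identityˡ _ ⟩
      δ w x - δ u x
        ∎
      where open ≡-Reasoning

  walk-span : ∀ {u v} → Star (CoIncident H) u v → Span (λ x → δ v x - δ u x)
  walk-span {u} ε = span-≗ (λ x → sym (+-inverseʳ (δ u x))) span-0
  walk-span {u} {v} (_◅_ {j = w} (e , e∈E , u∈e , w∈e) walk) =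
    span-≗ telescope (span-+ (walk-span walk) (edge-span (Any.index e∈E) (on-edge u∈e) (on-edge w∈e)))
    where
    on-edge : ∀ {x} → x ∈ₛ e → x ∈ₛ edge H (Any.index e∈E)
    on-edge = subst (_ ∈ₛ_) (lookup-index e∈E)
    telescope : ∀ x → (δ v x - δ w x) + (δ w x - δ u x) ≡ δ v x - δ u x
    telescope x = solve 3 (λ a b c → (a :- b) :+ (b :- c) := a :- c) refl (δ v x) (δ w x) (δ u x)

mainTheorem5 : (r n : ℕ) (H : Hypergraph r (suc n)) → Connected H → HasRank (genIncidence H) n
mainTheorem5 r n H connected = c , independent⇒linIndepCols {c = c} indep-c , no-more-independent
  where
  open Columns (genIncidence H)
  spanned : ∀ i → Span (λ x → δ (suc i) x - δ zero x)
  spanned i = walk-span H (connected zero (suc i))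
  lower : Σ[ c ∈ (Fin n → Incidence H) ] Independent (columns c)
  lower = independent-columns δ-differences-independent spanned
  c : Fin n → Incidence H
  c = proj₁ lower
  indep-c : Independent (columns c)
  indep-c = proj₂ lower
  no-more-independent : (c′ : Fin (suc n) → Incidence H) → LinIndepCols (genIncidence H) (suc n) c′ → ⊥
  no-more-independent c′ indep′ =
    ℕ.1+n≰n (sumZero-independent⇒≤ {V = columns c′} (λ j → genIncidence-column-sum H (c′ j))
                                    (linIndepCols⇒independent {c = c′} indep′))
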